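{- Let $\mathcal{P}$ be a nonempty finite set of odd primes and put $m=\prod_{p\in\mathcal{P}}p$. Then $\bigcap_{p\in\mathcal{P}}\mathcal{F}_p$ is nonempty if and only if $m\in\mathcal{M}$. If this is the case, then $\bigcap_{p\in\mathcal{P}}\mathcal{F}_p$ is an arithmetic progression (a single residue class of positive integers) with common difference $2m\lambda(m)$.
   Context: For an odd prime $p$, $\mathcal{F}_p$ is the set of positive integers $n$ with $n\equiv p^2\pmod{2p(p-1)}$. $\mathcal{M}=\{m>2:\gcd(m,\varphi(m))=1\}$, where $\varphi$ is Euler's totient function. For squarefree $m$ as here, $\lambda(m)=\operatorname{lcm}[p-1: p\in\mathcal{P}]$ is the Carmichael function of $m$. -}

module Defs where

open import Data.Nat using (ℕ; suc; _*_; _∸_; _<_; _≟_)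
open import Data.Nat.GCD using (gcd)
open import Data.Nat.LCM using (lcm)
open import Data.Nat.Primality using (Prime)
open import Data.Nat.Divisibility using (_∣_)
open import Data.Integer using (ℤ; +_; _-_)
import Data.Integer.Divisibility as ℤDiv
open import Data.List using (List; length; filter; map; upTo; foldr)
open import Data.Product using (_×_)
open import Relation.Nullary using (¬_)
open import Relation.Binary.PropositionalEquality using (_≡_)

OddPrime : ℕ → Set
OddPrime p = Prime p × ¬ (2 ∣ p)

_≡_[mod_] : ℕ → ℕ → ℕ → Set
a ≡ b [mod d ] = (+ d) ℤDiv.∣ ((+ a) - (+ b))

InF : ℕ → ℕ → Set
InF p n = 0 < n × n ≡ p * p [mod 2 * p * (p ∸ 1) ]

totient : ℕ → ℕ
totient m = length (filter (λ k → gcd k m ≟ 1) (map suc (upTo m)))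

InM : ℕ → Set
InM m = 2 < m × gcd m (totient m) ≡ 1

-- Carmichael function of the squarefree number ∏_{p∈P} p, given (as in the
-- paper) by lcm[p - 1 : p ∈ P]
carmichaelSqfree : List ℕ → ℕ
carmichaelSqfree P = foldr (λ p acc → lcm (p ∸ 1) acc) 1 P

module Submission where

-- Let P be a nonempty list of distinct odd primes, m = ∏ P and λ = lcm [p - 1 : p ∈ P].
-- The proof reduces everything to one pair of congruence conditions:
--
--   * for an odd prime p, n ∈ 𝓕_p  ⇔  p ∣ n  and  n ≡ 1 (mod 2(p-1)),
--     because 2p(p-1) = p · 2(p-1) with coprime factors (Chinese remainder
--     theorem) and p² ≡ 0 (mod p), p² ≡ 1 (mod 2(p-1));
--   * hence n ∈ ⋂ 𝓕_p  ⇔  m ∣ n  and  n ≡ 1 (mod 2λ), since distinct primes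
--     divide n iff their product does, and congruences modulo the 2(p-1)
--     combine into one modulo their lcm 2λ.
--
-- Such n exist iff gcd(m, 2λ) = 1 (Chinese remainder theorem), and then they
-- form one residue class modulo 2mλ.  Finally gcd(m, 2λ) = 1 is the condition
-- m ∈ 𝓜: m is odd and > 2, and φ(m) = ∏ (p - 1) (multiplicativity of φ,
-- proved by counting) has the same prime divisors as λ.

open import Defs
open import Data.Nat using (ℕ; _*_; _<_)
open import Data.List using (List; [])
open import Data.Nat.ListAction using (product)
open import Data.List.Relation.Unary.All using (All)
open import Data.List.Relation.Unary.Unique.Propositional using (Unique)
open import Data.Product using (_×_; ∃)
open import Function.Bundles using (_⇔_)
open import Relation.Binary.PropositionalEquality using (_≢_)

open import Data.Nat using (zero; suc; _+_; _∸_; _≤_; z≤n; s≤s; NonZero; nonTrivial⇒n>1)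
open import Data.Nat.Properties
open import Data.Nat.Divisibility
open import Data.Nat.DivMod using (_%_; _/_; m≡m%n+[m/n]*n; m%n<n)
open import Data.Nat.Coprimality using (Coprime; coprime?; coprime⇒gcd≡1; gcd≡1⇒coprime; coprime-divisor; coprime-Bézout)
import Data.Nat.Coprimality as Coprime
open import Data.Nat.GCD using (gcd; module Bézout)
open import Data.Nat.LCM using (lcm; lcm-least; gcd*lcm; m∣lcm[m,n]; n∣lcm[m,n])
open import Data.Nat.Primality using (Prime; prime[2]; prime⇒irreducible; prime⇒nonTrivial; euclidsLemma; productOfPrimes≢0)
import Data.Nat.Tactic.RingSolver as ℕ-Ring
open import Data.List using (_∷_; [_]; _++_; length; filter; map; upTo)
import Data.List.Properties as List
open import Data.List.Relation.Unary.All using ([]; _∷_)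
import Data.List.Relation.Unary.All as All
import Data.List.Relation.Unary.All.Properties as All
open import Data.List.Relation.Unary.AllPairs using ([]; _∷_)
open import Data.Product using (_,_; proj₁; proj₂)
open import Data.Product.Function.NonDependent.Propositional using (_×-⇔_)
open import Data.Sum using (inj₁; inj₂)
open import Data.Empty using (⊥-elim)
open import Function.Bundles using (mk⇔; Equivalence)
import Function.Properties.Equivalence as ⇔
open import Relation.Nullary using (¬_; Dec; yes; no)
open import Relation.Binary.PropositionalEquality using (_≡_; refl; sym; trans; cong; cong₂; subst; module ≡-Reasoning)

open Equivalence using (to; from)

-- Primes and coprimality

prime≢1 : ∀ {p} → Prime p → p ≢ 1
prime≢1 pp refl with nonTrivial⇒n>1 1 {{prime⇒nonTrivial pp}}
... | s≤s ()

oddPrime≥3 : ∀ {p} → OddPrime p → 3 ≤ p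
oddPrime≥3 {0} (pp , _) with nonTrivial⇒n>1 0 {{prime⇒nonTrivial pp}}
... | ()
oddPrime≥3 {1} (pp , _) = ⊥-elim (prime≢1 pp refl)
oddPrime≥3 {2} (_ , 2∤2) = ⊥-elim (2∤2 ∣-refl)
oddPrime≥3 {suc (suc (suc _))} _ = s≤s (s≤s (s≤s z≤n))

prime-coprime : ∀ {p x} → Prime p → ¬ p ∣ x → Coprime p x
prime-coprime pp p∤x {d} (d∣p , d∣x) with prime⇒irreducible pp d∣p
... | inj₁ d≡1 = d≡1
... | inj₂ refl = ⊥-elim (p∤x d∣x)

coprime-* : ∀ {a b c} → Coprime a b → Coprime a c → Coprime a (b * c)
coprime-* {a} {b} coprime-ab coprime-ac {d} (d∣a , d∣bc) =
  coprime-ac (d∣a , coprime-divisor coprime-db d∣bc)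
  where
  coprime-db : Coprime d b
  coprime-db (e∣d , e∣b) = coprime-ab (∣-trans e∣d d∣a , e∣b)

coprime-∣ : ∀ {a b c} → Coprime a b → c ∣ b → Coprime a c
coprime-∣ coprime-ab c∣b (d∣a , d∣c) = coprime-ab (d∣a , ∣-trans d∣c c∣b)

coprime-product : ∀ {a} (ds : List ℕ) → All (Coprime a) ds → Coprime a (product ds)
coprime-product [] [] (_ , d∣1) = ∣1⇒≡1 d∣1
coprime-product (d ∷ ds) (c ∷ cs) = coprime-* c (coprime-product ds cs)

-- Coprime divisors of x divide x jointly, since their lcm is their product.
coprime-∣-* : ∀ {a b x} → Coprime a b → a ∣ x → b ∣ x → a * b ∣ x
coprime-∣-* {a} {b} coprime-ab a∣x b∣x = subst (_∣ _) lcm≡* (lcm-least a∣x b∣x)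
  where
  lcm≡* : lcm a b ≡ a * b
  lcm≡* = trans (sym (*-identityˡ (lcm a b)))
                (trans (cong (_* lcm a b) (sym (coprime⇒gcd≡1 coprime-ab))) (gcd*lcm a b))

prime-∤-product : ∀ {p} (Q : List ℕ) → Prime p → All Prime Q → All (p ≢_) Q → ¬ p ∣ product Q
prime-∤-product [] pp _ _ p∣1 = prime≢1 pp (∣1⇒≡1 p∣1)
prime-∤-product (q ∷ Q) pp (pq ∷ pQ) (p≢q ∷ p≢Q) p∣qQ with euclidsLemma q (product Q) pp p∣qQ
... | inj₂ p∣Q = prime-∤-product Q pp pQ p≢Q p∣Q
... | inj₁ p∣q with prime⇒irreducible pq p∣q
...   | inj₁ p≡1 = prime≢1 pp p≡1
...   | inj₂ p≡q = p≢q p≡q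

head-coprime-tail : ∀ {p} Q → Prime p → All Prime Q → All (p ≢_) Q → Coprime p (product Q)
head-coprime-tail Q pp pQ p∉Q = prime-coprime pp (prime-∤-product Q pp pQ p∉Q)

-- Finite sums, and φ(p·r) = (p - 1) φ(r) for a prime p ∤ r

indicator : ∀ {a} {A : Set a} → Dec A → ℕ
indicator (yes _) = 1
indicator (no _) = 0

indicator-cong : ∀ {A B : Set} → (A → B) → (B → A) → (a : Dec A) (b : Dec B) → indicator a ≡ indicator b
indicator-cong A→B B→A (yes _) (yes _) = refl
indicator-cong A→B B→A (yes a) (no ¬b) = ⊥-elim (¬b (A→B a))
indicator-cong A→B B→A (no ¬a) (yes b) = ⊥-elim (¬a (B→A b))
indicator-cong A→B B→A (no _) (no _) = refl

sumTo : (ℕ → ℕ) → ℕ → ℕ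
sumTo f zero = 0
sumTo f (suc n) = sumTo f n + f (suc n)

sumTo-cong : ∀ {f g : ℕ → ℕ} n → (∀ k → k < n → f (suc k) ≡ g (suc k)) → sumTo f n ≡ sumTo g n
sumTo-cong zero f≗g = refl
sumTo-cong (suc n) f≗g = cong₂ _+_ (sumTo-cong n (λ k k<n → f≗g k (m<n⇒m<1+n k<n))) (f≗g n (n<1+n n))

sumTo-vanish : ∀ {f : ℕ → ℕ} n → (∀ k → k < n → f (suc k) ≡ 0) → sumTo f n ≡ 0
sumTo-vanish zero _ = refl
sumTo-vanish (suc n) f≡0 =
  cong₂ _+_ (sumTo-vanish n (λ k k<n → f≡0 k (m<n⇒m<1+n k<n))) (f≡0 n (n<1+n n))

sumTo-+ : ∀ (f g : ℕ → ℕ) n → sumTo (λ k → f k + g k) n ≡ sumTo f n + sumTo g n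
sumTo-+ f g zero = refl
sumTo-+ f g (suc n) rewrite sumTo-+ f g n = +-interchange (sumTo f n) (sumTo g n) (f (suc n)) (g (suc n))
  where
  +-interchange : ∀ a b c d → a + b + (c + d) ≡ a + c + (b + d)
  +-interchange = ℕ-Ring.solve-∀

sumTo-split : ∀ (f : ℕ → ℕ) a b → sumTo f (a + b) ≡ sumTo f a + sumTo (λ k → f (a + k)) b
sumTo-split f a zero rewrite +-identityʳ a = sym (+-identityʳ (sumTo f a))
sumTo-split f a (suc b) rewrite +-suc a b | sumTo-split f a b = +-assoc (sumTo f a) _ _

sumTo-periodic : ∀ (f : ℕ → ℕ) r → (∀ k → f (r + k) ≡ f k) → ∀ q → sumTo f (q * r) ≡ q * sumTo f r
sumTo-periodic f r periodic zero = refl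
sumTo-periodic f r periodic (suc q) = begin
  sumTo f (r + q * r)                           ≡⟨ sumTo-split f r (q * r) ⟩
  sumTo f r + sumTo (λ k → f (r + k)) (q * r)   ≡⟨ cong (sumTo f r +_) (sumTo-cong (q * r) (λ k _ → periodic (suc k))) ⟩
  sumTo f r + sumTo f (q * r)                   ≡⟨ cong (sumTo f r +_) (sumTo-periodic f r periodic q) ⟩
  sumTo f r + q * sumTo f r                     ∎
  where open ≡-Reasoning

multipleOf : ℕ → ℕ → ℕ
multipleOf p k = indicator (p ∣? k)

multipleOf-inside : ∀ p' r k → k < p' → multipleOf (suc p') (suc p' * r + suc k) ≡ 0
multipleOf-inside p' r k k<p' with suc p' ∣? (suc p' * r + suc k)
... | no _ = refl
... | yes p∣ = ⊥-elim (<-irrefl refl (≤-trans (s≤s k<p') (∣⇒≤ (∣m+n∣m⇒∣n p∣ (m∣m*n r)))))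

multipleOf-multiple : ∀ p r → multipleOf p (p * r) ≡ 1
multipleOf-multiple p r with p ∣? (p * r)
... | yes _ = refl
... | no p∤pr = ⊥-elim (p∤pr (m∣m*n r))

sumTo-multiples : ∀ (f : ℕ → ℕ) p' r → sumTo (λ k → f k * multipleOf (suc p') k) (suc p' * r) ≡ sumTo (λ j → f (suc p' * j)) r
sumTo-multiples f p' zero rewrite *-zeroʳ p' = refl
sumTo-multiples f p' (suc r) = begin
  sumTo g (p * suc r)                            ≡⟨ cong (sumTo g) p[r+1] ⟩
  sumTo g (p * r + p)                            ≡⟨ sumTo-split g (p * r) p ⟩
  sumTo g (p * r) + (inside + g (p * r + p))     ≡⟨ cong (_+ (inside + g (p * r + p))) (sumTo-multiples f p' r) ⟩
  earlier + (inside + g (p * r + p))             ≡⟨ cong (λ t → earlier + (t + g (p * r + p))) inside≡0 ⟩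
  earlier + g (p * r + p)                        ≡⟨ cong (λ k → earlier + g k) (sym p[r+1]) ⟩
  earlier + f (p * suc r) * multipleOf p (p * suc r)
                                                 ≡⟨ cong (λ i → earlier + f (p * suc r) * i) (multipleOf-multiple p (suc r)) ⟩
  earlier + f (p * suc r) * 1                    ≡⟨ cong (earlier +_) (*-identityʳ (f (p * suc r))) ⟩
  earlier + f (p * suc r)                        ∎
  where
  open ≡-Reasoning
  p : ℕ
  p = suc p'
  g : ℕ → ℕ
  g k = f k * multipleOf p k
  earlier : ℕ
  earlier = sumTo (λ j → f (p * j)) r
  inside : ℕ
  inside = sumTo (λ k → g (p * r + k)) p'
  inside≡0 : inside ≡ 0
  inside≡0 = sumTo-vanish p' (λ k k<p' →
    trans (cong (f (p * r + suc k) *_) (multipleOf-inside p' r k k<p')) (*-zeroʳ (f (p * r + suc k))))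
  p[r+1] : p * suc r ≡ p * r + p
  p[r+1] = trans (*-suc p r) (+-comm p (p * r))

count≡sumTo : ∀ {P : ℕ → Set} (P? : ∀ k → Dec (P k)) n →
  length (filter P? (map suc (upTo n))) ≡ sumTo (λ k → indicator (P? k)) n
count≡sumTo P? zero = refl
count≡sumTo P? (suc n) = begin
  length (filter P? (map suc (upTo (suc n))))                      ≡⟨ cong (λ l → length (filter P? (map suc l))) (sym (List.upTo-∷ʳ n)) ⟩
  length (filter P? (map suc (upTo n ++ [ n ])))                   ≡⟨ cong (λ l → length (filter P? l)) (List.map-++ suc (upTo n) [ n ]) ⟩
  length (filter P? (map suc (upTo n) ++ [ suc n ]))               ≡⟨ cong length (List.filter-++ P? (map suc (upTo n)) [ suc n ]) ⟩
  length (filter P? (map suc (upTo n)) ++ filter P? [ suc n ])     ≡⟨ List.length-++ (filter P? (map suc (upTo n))) ⟩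
  length (filter P? (map suc (upTo n))) + length (filter P? [ suc n ])
                                                                   ≡⟨ cong₂ _+_ (count≡sumTo P? n) last ⟩
  sumTo (λ k → indicator (P? k)) n + indicator (P? (suc n))        ∎
  where
  open ≡-Reasoning
  last : length (filter P? [ suc n ]) ≡ indicator (P? (suc n))
  last with P? (suc n)
  ... | yes _ = refl
  ... | no _ = refl

coprimeTo : ℕ → ℕ → ℕ
coprimeTo r k = indicator (coprime? k r)

totient≡sumTo : ∀ r → totient r ≡ sumTo (coprimeTo r) r
totient≡sumTo r = trans (count≡sumTo (λ k → gcd k r ≟ 1) r)
  (sumTo-cong r (λ k _ → indicator-cong gcd≡1⇒coprime coprime⇒gcd≡1 _ _))

coprimeTo-periodic : ∀ r k → coprimeTo r (r + k) ≡ coprimeTo r k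
coprimeTo-periodic r k = indicator-cong shift unshift _ _
  where
  shift : Coprime (r + k) r → Coprime k r
  shift c (d∣k , d∣r) = c (∣m∣n⇒∣m+n d∣r d∣k , d∣r)
  unshift : Coprime k r → Coprime (r + k) r
  unshift c (d∣r+k , d∣r) = c (∣m+n∣m⇒∣n d∣r+k d∣r , d∣r)

coprimeTo-scale : ∀ {p r} j → Coprime p r → coprimeTo r (p * j) ≡ coprimeTo r j
coprimeTo-scale {p} {r} j coprime-pr = indicator-cong cancel scale _ _
  where
  cancel : Coprime (p * j) r → Coprime j r
  cancel c (d∣j , d∣r) = c (∣n⇒∣m*n p d∣j , d∣r)
  scale : Coprime j r → Coprime (p * j) r
  scale c = Coprime.sym (coprime-* (Coprime.sym coprime-pr) (Coprime.sym c))

coprimeTo-split : ∀ {p r} → Prime p → ∀ k → coprimeTo r k ≡ coprimeTo (p * r) k + coprimeTo r k * multipleOf p k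
coprimeTo-split {p} {r} pp k with p ∣? k
... | yes p∣k = trans (sym (*-identityʳ (coprimeTo r k))) (cong (_+ coprimeTo r k * 1) (sym not-coprime))
  where
  not-coprime : coprimeTo (p * r) k ≡ 0
  not-coprime with coprime? k (p * r)
  ... | no _ = refl
  ... | yes c = ⊥-elim (prime≢1 pp (c (p∣k , m∣m*n r)))
... | no p∤k = trans (indicator-cong widen narrow _ _)
                     (sym (trans (cong (coprimeTo (p * r) k +_) (*-zeroʳ (coprimeTo r k))) (+-identityʳ _)))
  where
  widen : Coprime k r → Coprime k (p * r)
  widen c = coprime-* (Coprime.sym (prime-coprime pp p∤k)) c
  narrow : Coprime k (p * r) → Coprime k r
  narrow c (d∣k , d∣r) = c (d∣k , ∣n⇒∣m*n p d∣r)

-- Counting 1‥p·r: p·φ(r) numbers are coprime to r, of which φ(r) are multiples of p.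
totient-prime-* : ∀ {p r} → Prime p → Coprime p r → totient (p * r) ≡ (p ∸ 1) * totient r
totient-prime-* {zero} pp _ with nonTrivial⇒n>1 0 {{prime⇒nonTrivial pp}}
... | ()
totient-prime-* {suc p'} {r} pp coprime-pr = +-cancelʳ-≡ (totient r) (totient (p * r)) (p' * totient r) counted
  where
  open ≡-Reasoning
  p : ℕ
  p = suc p'
  counted : totient (p * r) + totient r ≡ p' * totient r + totient r
  counted = begin
    totient (p * r) + totient r
      ≡⟨ cong₂ _+_ (totient≡sumTo (p * r)) (totient≡sumTo r) ⟩
    sumTo (coprimeTo (p * r)) (p * r) + sumTo (coprimeTo r) r
      ≡⟨ cong (sumTo (coprimeTo (p * r)) (p * r) +_) (sym (sumTo-cong r (λ k _ → coprimeTo-scale (suc k) coprime-pr))) ⟩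
    sumTo (coprimeTo (p * r)) (p * r) + sumTo (λ j → coprimeTo r (p * j)) r
      ≡⟨ cong (sumTo (coprimeTo (p * r)) (p * r) +_) (sym (sumTo-multiples (coprimeTo r) p' r)) ⟩
    sumTo (coprimeTo (p * r)) (p * r) + sumTo (λ k → coprimeTo r k * multipleOf p k) (p * r)
      ≡⟨ sym (sumTo-+ (coprimeTo (p * r)) (λ k → coprimeTo r k * multipleOf p k) (p * r)) ⟩
    sumTo (λ k → coprimeTo (p * r) k + coprimeTo r k * multipleOf p k) (p * r)
      ≡⟨ sym (sumTo-cong (p * r) (λ k _ → coprimeTo-split pp (suc k))) ⟩
    sumTo (coprimeTo r) (p * r)
      ≡⟨ sumTo-periodic (coprimeTo r) r (coprimeTo-periodic r) p ⟩
    p * sumTo (coprimeTo r) r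
      ≡⟨ cong (p *_) (sym (totient≡sumTo r)) ⟩
    totient r + p' * totient r
      ≡⟨ +-comm (totient r) (p' * totient r) ⟩
    p' * totient r + totient r ∎

totient-squarefree : ∀ P → Unique P → All Prime P → totient (product P) ≡ product (map (_∸ 1) P)
totient-squarefree [] _ _ = refl
totient-squarefree (p ∷ Q) (p∉Q ∷ uQ) (pp ∷ pQ) =
  trans (totient-prime-* pp (head-coprime-tail Q pp pQ p∉Q)) (cong ((p ∸ 1) *_) (totient-squarefree Q uQ pQ))

-- The set 𝓜

∣carmichael : ∀ P → All (λ p → (p ∸ 1) ∣ carmichaelSqfree P) P
∣carmichael [] = []
∣carmichael (p ∷ Q) = m∣lcm[m,n] (p ∸ 1) (carmichaelSqfree Q)
                    ∷ All.map (λ d∣λQ → ∣-trans d∣λQ (n∣lcm[m,n] (p ∸ 1) (carmichaelSqfree Q))) (∣carmichael Q)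

carmichael∣product : ∀ P → carmichaelSqfree P ∣ product (map (_∸ 1) P)
carmichael∣product [] = ∣-refl
carmichael∣product (p ∷ Q) = lcm-least (m∣m*n {p ∸ 1} (product (map (_∸ 1) Q))) (∣n⇒∣m*n (p ∸ 1) (carmichael∣product Q))

allPrime : ∀ {P} → All OddPrime P → All Prime P
allPrime = All.map proj₁

product-odd : ∀ P → All OddPrime P → ¬ 2 ∣ product P
product-odd P oddP = prime-∤-product P prime[2] (allPrime oddP) (All.map (λ { (_ , 2∤p) refl → 2∤p ∣-refl }) oddP)

product>2 : ∀ P → All OddPrime P → P ≢ [] → 2 < product P
product>2 [] _ P≢[] = ⊥-elim (P≢[] refl)
product>2 (p ∷ Q) (op ∷ oQ) _ = ≤-trans (oddPrime≥3 op) (m≤m*n p (product Q) {{productOfPrimes≢0 (allPrime oQ)}})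

-- ∏ P ∈ 𝓜 iff ∏ P is coprime to 2λ: ∏ P is odd, and coprimality to
-- φ(∏ P) = ∏ (p - 1) is coprimality to each p - 1, i.e. to λ.
InM⇔coprime : ∀ P → Unique P → All OddPrime P → P ≢ [] → InM (product P) ⇔ Coprime (product P) (2 * carmichaelSqfree P)
InM⇔coprime P uP oddP P≢[] = mk⇔ forward backward
  where
  m : ℕ
  m = product P
  φ[m]≡ : totient m ≡ product (map (_∸ 1) P)
  φ[m]≡ = totient-squarefree P uP (allPrime oddP)
  forward : InM m → Coprime m (2 * carmichaelSqfree P)
  forward (_ , gcd≡1) = coprime-* (Coprime.sym (prime-coprime prime[2] (product-odd P oddP)))
    (coprime-∣ (subst (Coprime m) φ[m]≡ (gcd≡1⇒coprime gcd≡1)) (carmichael∣product P))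
  backward : Coprime m (2 * carmichaelSqfree P) → InM m
  backward c = product>2 P oddP P≢[] , trans (cong (gcd m) φ[m]≡) (coprime⇒gcd≡1
    (coprime-product (map (_∸ 1) P) (All.map⁺ (All.map (λ p-1∣λ {_} → coprime-∣ c (∣n⇒∣m*n 2 p-1∣λ)) (∣carmichael P)))))

-- Congruences and the Chinese remainder theorem

*-lcm-least : ∀ k .{{_ : NonZero k}} {a b x} → k * a ∣ x → k * b ∣ x → k * lcm a b ∣ x
*-lcm-least k {a} {b} {x} (divides q x≡q[ka]) kb∣x =
  subst (k * lcm a b ∣_) (sym x≡k[qa]) (*-monoʳ-∣ k (lcm-least (n∣m*n q) b∣qa))
  where
  x≡k[qa] : x ≡ k * (q * a)
  x≡k[qa] = trans x≡q[ka] (reassociate q k a)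
    where
    reassociate : ∀ q k a → q * (k * a) ≡ k * (q * a)
    reassociate = ℕ-Ring.solve-∀
  b∣qa : b ∣ q * a
  b∣qa = *-cancelˡ-∣ k (subst (k * b ∣_) x≡k[qa] kb∣x)

module Congruence where
  open import Data.Integer using (ℤ; +_; ∣_∣) renaming (_+_ to _+ℤ_; _*_ to _*ℤ_; _-_ to _-ℤ_)
  import Data.Integer.Properties as ℤ
  open import Data.Integer.Divisibility.Signed using (divides; ∣ᵤ⇒∣; ∣⇒∣ᵤ) renaming (_∣_ to _∣ℤ_)
  import Data.Integer.Divisibility.Signed as ℤ∣
  import Data.Integer.Tactic.RingSolver as ℤ-Ring

  -- a ≋ b ⟨mod d⟩: d divides a - b in ℤ.  A record, so that a, b, d can be inferred.
  infix 4 _≋_⟨mod_⟩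
  record _≋_⟨mod_⟩ (a b d : ℕ) : Set where
    constructor congruent
    field divides-difference : + d ∣ℤ (+ a -ℤ + b)
  open _≋_⟨mod_⟩

  ≡[mod]⇔≋ : ∀ {a b d} → a ≡ b [mod d ] ⇔ a ≋ b ⟨mod d ⟩
  ≡[mod]⇔≋ = mk⇔ (λ d∣ → congruent (∣ᵤ⇒∣ d∣)) (λ a≋b → ∣⇒∣ᵤ (divides-difference a≋b))

  ≋-sym : ∀ {a b d} → a ≋ b ⟨mod d ⟩ → b ≋ a ⟨mod d ⟩
  ≋-sym {a} {b} {d} (congruent d∣) = congruent (∣ᵤ⇒∣ (subst (d ∣_) (ℤ.∣i-j∣≡∣j-i∣ (+ a) (+ b)) (∣⇒∣ᵤ d∣)))

  ≋-trans : ∀ {a b c d} → a ≋ b ⟨mod d ⟩ → b ≋ c ⟨mod d ⟩ → a ≋ c ⟨mod d ⟩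
  ≋-trans {a} {b} {c} {d} (congruent d∣a-b) (congruent d∣b-c) =
    congruent (subst (+ d ∣ℤ_) (ℤ.+-minus-telescope (+ a) (+ b) (+ c)) (ℤ∣.∣m∣n⇒∣m+n d∣a-b d∣b-c))

  ≋-weaken : ∀ {a b d e} → e ∣ d → a ≋ b ⟨mod d ⟩ → a ≋ b ⟨mod e ⟩
  ≋-weaken e∣d (congruent d∣) = congruent (ℤ∣.∣-trans (∣ᵤ⇒∣ e∣d) d∣)

  ∣⇒≋0 : ∀ {a d} → d ∣ a → a ≋ 0 ⟨mod d ⟩
  ∣⇒≋0 {a} {d} d∣a = congruent (∣ᵤ⇒∣ (subst (d ∣_) (sym (cong ∣_∣ (ℤ.+-identityʳ (+ a)))) d∣a))

  ≋0⇒∣ : ∀ {a d} → a ≋ 0 ⟨mod d ⟩ → d ∣ a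
  ≋0⇒∣ {a} {d} (congruent d∣) = subst (d ∣_) (cong ∣_∣ (ℤ.+-identityʳ (+ a))) (∣⇒∣ᵤ d∣)

  ≋-shift : ∀ {a b d} q r → a + q * d ≡ b + r * d → a ≋ b ⟨mod d ⟩
  ≋-shift {a} {b} {d} q r eq = congruent (divides (+ r -ℤ + q) (begin
    + a -ℤ + b                              ≡⟨ regroup (+ a) (+ b) (+ q) (+ r) (+ d) ⟩
    (A -ℤ B) +ℤ (+ r -ℤ + q) *ℤ + d         ≡⟨ cong (λ X → (X -ℤ B) +ℤ (+ r -ℤ + q) *ℤ + d) A≡B ⟩
    (B -ℤ B) +ℤ (+ r -ℤ + q) *ℤ + d         ≡⟨ cancel B ((+ r -ℤ + q) *ℤ + d) ⟩
    (+ r -ℤ + q) *ℤ + d                     ∎))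
    where
    open ≡-Reasoning
    A B : ℤ
    A = + a +ℤ + q *ℤ + d
    B = + b +ℤ + r *ℤ + d
    embed : ∀ x y z → + (x + y * z) ≡ + x +ℤ + y *ℤ + z
    embed x y z = trans (ℤ.pos-+ x (y * z)) (cong (+ x +ℤ_) (ℤ.pos-* y z))
    A≡B : A ≡ B
    A≡B = trans (sym (embed a q d)) (trans (cong +_ eq) (embed b r d))
    regroup : ∀ (x y s t z : ℤ) → x -ℤ y ≡ ((x +ℤ s *ℤ z) -ℤ (y +ℤ t *ℤ z)) +ℤ (t -ℤ s) *ℤ z
    regroup = ℤ-Ring.solve-∀
    cancel : ∀ (x y : ℤ) → (x -ℤ x) +ℤ y ≡ y
    cancel = ℤ-Ring.solve-∀

  ≋-crt : ∀ {a b d e} → Coprime d e → a ≋ b ⟨mod d * e ⟩ ⇔ (a ≋ b ⟨mod d ⟩ × a ≋ b ⟨mod e ⟩)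
  ≋-crt {d = d} {e} coprime-de = mk⇔
    (λ a≋b → ≋-weaken (m∣m*n e) a≋b , ≋-weaken (n∣m*n d) a≋b)
    (λ { (congruent d∣ , congruent e∣) → congruent (∣ᵤ⇒∣ (coprime-∣-* coprime-de (∣⇒∣ᵤ d∣) (∣⇒∣ᵤ e∣))) })

  ≋-*lcm : ∀ {n c} k .{{_ : NonZero k}} {a b} → n ≋ c ⟨mod k * a ⟩ → n ≋ c ⟨mod k * b ⟩ → n ≋ c ⟨mod k * lcm a b ⟩
  ≋-*lcm k (congruent ka∣) (congruent kb∣) = congruent (∣ᵤ⇒∣ (*-lcm-least k (∣⇒∣ᵤ ka∣) (∣⇒∣ᵤ kb∣)))

open Congruence

≋1⇒positive : ∀ {n k} → n ≋ 1 ⟨mod 2 * k ⟩ → 0 < n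
≋1⇒positive {zero} {k} 0≋1 with ∣1⇒≡1 (≋0⇒∣ (≋-sym (≋-weaken (m∣m*n {2} k) 0≋1)))
... | ()
≋1⇒positive {suc n} _ = s≤s z≤n

crt-exists : ∀ {m M} → Coprime m M → ∃ λ n → m ∣ n × n ≋ 1 ⟨mod M ⟩
crt-exists {m} {M} coprime-mM with coprime-Bézout coprime-mM
... | Bézout.+- x y 1+yM≡xm = x * m , n∣m*n x , ≋-shift 0 y (trans (+-identityʳ (x * m)) (sym 1+yM≡xm))
... | Bézout.-+ x y 1+xm≡yM with M
...   | zero = ⊥-elim (0≢1+n (trans (sym (*-zeroʳ y)) (sym 1+xm≡yM)))
...   | suc M' = x * m * M' , ∣m⇒∣m*n M' (n∣m*n x) , ≋-shift y (x * m) (begin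
  x * m * M' + y * suc M'   ≡⟨ cong (x * m * M' +_) (sym 1+xm≡yM) ⟩
  x * m * M' + (1 + x * m)  ≡⟨ regroup (x * m) M' ⟩
  1 + x * m * suc M'        ∎)
  where
  open ≡-Reasoning
  regroup : ∀ a b → a * b + (1 + a) ≡ 1 + a * suc b
  regroup = ℕ-Ring.solve-∀

crt-necessary : ∀ {m M n} → m ∣ n → n ≋ 1 ⟨mod M ⟩ → Coprime m M
crt-necessary m∣n n≋1 (d∣m , d∣M) =
  ∣1⇒≡1 (≋0⇒∣ (≋-trans (≋-sym (≋-weaken d∣M n≋1)) (∣⇒≋0 (∣-trans d∣m m∣n))))

crt-solutions : ∀ {m M a} → Coprime m M → m ∣ a → a ≋ 1 ⟨mod M ⟩ →
  ∀ n → (m ∣ n × n ≋ 1 ⟨mod M ⟩) ⇔ n ≋ a ⟨mod m * M ⟩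
crt-solutions coprime-mM m∣a a≋1 n = mk⇔
  (λ (m∣n , n≋1) → from (≋-crt coprime-mM)
    (≋-trans (∣⇒≋0 m∣n) (≋-sym (∣⇒≋0 m∣a)) , ≋-trans n≋1 (≋-sym a≋1)))
  (λ n≋a → let (n≋a[m] , n≋a[M]) = to (≋-crt coprime-mM) n≋a in
    ≋0⇒∣ (≋-trans n≋a[m] (∣⇒≋0 m∣a)) , ≋-trans n≋a[M] a≋1)

2*-swap : ∀ x y → 2 * x * y ≡ x * (2 * y)
2*-swap = ℕ-Ring.solve-∀

-- Restating a residue class modulo m·2k containing a number ≡ 1 mod 2k in the
-- form of the theorem: its members are automatically positive.
residue-class⇔ : ∀ m k {a n} → a ≋ 1 ⟨mod 2 * k ⟩ → n ≋ a ⟨mod m * (2 * k) ⟩ ⇔ (0 < n × n ≡ a [mod 2 * m * k ])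
residue-class⇔ m k {a} {n} a≋1 = mk⇔
  (λ n≋a → ≋1⇒positive {k = k} (≋-trans (≋-weaken (n∣m*n m) n≋a) a≋1)
         , from ≡[mod]⇔≋ (subst (λ d → n ≋ a ⟨mod d ⟩) (sym (2*-swap m k)) n≋a))
  (λ (_ , n≡a) → subst (λ d → n ≋ a ⟨mod d ⟩) (2*-swap m k) (to ≡[mod]⇔≋ n≡a))

-- The sets 𝓕_p and their intersection

odd⇒1+2j : ∀ {p} → ¬ 2 ∣ p → ∃ λ j → p ≡ suc (j * 2)
odd⇒1+2j {p} 2∤p with p % 2 | m≡m%n+[m/n]*n p 2 | m%n<n p 2
... | 0 | p≡ | _ = ⊥-elim (2∤p (divides (p / 2) p≡))
... | 1 | p≡ | _ = p / 2 , p≡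
... | suc (suc _) | _ | s≤s (s≤s ())

-- For odd p, p² ≡ 1 mod 2(p - 1): p² - 1 = (p - 1)(p + 1) and p + 1 is even.
odd-square≋1 : ∀ {p} → ¬ 2 ∣ p → p * p ≋ 1 ⟨mod 2 * (p ∸ 1) ⟩
odd-square≋1 2∤p with odd⇒1+2j 2∤p
... | j , refl = ≋-shift 0 (suc j) (expand j)
  where
  expand : ∀ j → suc (j * 2) * suc (j * 2) + 0 ≡ 1 + suc j * (2 * (j * 2))
  expand = ℕ-Ring.solve-∀

oddPrime-coprime : ∀ {p} → OddPrime p → Coprime p (2 * (p ∸ 1))
oddPrime-coprime {p} op@(pp , _) = prime-coprime pp p∤2[p-1]
  where
  p∤p-1 : ∀ {p} → 3 ≤ p → ¬ p ∣ (p ∸ 1)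
  p∤p-1 {suc (suc (suc k))} _ p∣p-1 = <-irrefl refl (≤-trans (s≤s ≤-refl) (∣⇒≤ p∣p-1))
  p∤p-1 {suc zero} (s≤s ())
  p∤p-1 {suc (suc zero)} (s≤s (s≤s ()))
  p∤2[p-1] : ¬ p ∣ 2 * (p ∸ 1)
  p∤2[p-1] p∣ with euclidsLemma 2 (p ∸ 1) pp p∣
  ... | inj₁ p∣2 = <-irrefl refl (≤-trans (oddPrime≥3 op) (∣⇒≤ p∣2))
  ... | inj₂ p∣p-1 = p∤p-1 (oddPrime≥3 op) p∣p-1

InF⇔ : ∀ {p n} → OddPrime p → InF p n ⇔ (p ∣ n × n ≋ 1 ⟨mod 2 * (p ∸ 1) ⟩)
InF⇔ {p} {n} op@(_ , 2∤p) = mk⇔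
  (λ (_ , n≡p²) → let (n≋p²[p] , n≋p²[2p-2]) = to (≋-crt coprime) (modulus⇒ (to ≡[mod]⇔≋ n≡p²)) in
    ≋0⇒∣ (≋-trans n≋p²[p] p²≋0) , ≋-trans n≋p²[2p-2] p²≋1)
  (λ (p∣n , n≋1) → ≋1⇒positive {k = p ∸ 1} n≋1 ,
    from ≡[mod]⇔≋ (modulus⇐ (from (≋-crt coprime) (≋-trans (∣⇒≋0 p∣n) (≋-sym p²≋0) , ≋-trans n≋1 (≋-sym p²≋1)))))
  where
  coprime : Coprime p (2 * (p ∸ 1))
  coprime = oddPrime-coprime op
  p²≋0 : p * p ≋ 0 ⟨mod p ⟩
  p²≋0 = ∣⇒≋0 (n∣m*n p)
  p²≋1 : p * p ≋ 1 ⟨mod 2 * (p ∸ 1) ⟩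
  p²≋1 = odd-square≋1 2∤p
  2p[p-1]≡ : 2 * p * (p ∸ 1) ≡ p * (2 * (p ∸ 1))
  2p[p-1]≡ = 2*-swap p (p ∸ 1)
  modulus⇒ : n ≋ p * p ⟨mod 2 * p * (p ∸ 1) ⟩ → n ≋ p * p ⟨mod p * (2 * (p ∸ 1)) ⟩
  modulus⇒ = subst (λ d → n ≋ p * p ⟨mod d ⟩) 2p[p-1]≡
  modulus⇐ : n ≋ p * p ⟨mod p * (2 * (p ∸ 1)) ⟩ → n ≋ p * p ⟨mod 2 * p * (p ∸ 1) ⟩
  modulus⇐ = subst (λ d → n ≋ p * p ⟨mod d ⟩) (sym 2p[p-1]≡)

≋-carmichael : ∀ {n c} P →
  (n ≋ c ⟨mod 2 ⟩ × All (λ p → n ≋ c ⟨mod 2 * (p ∸ 1) ⟩) P) ⇔ n ≋ c ⟨mod 2 * carmichaelSqfree P ⟩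
≋-carmichael {n} {c} P = mk⇔ (combine P) (separate P)
  where
  combine : ∀ P → n ≋ c ⟨mod 2 ⟩ × All (λ p → n ≋ c ⟨mod 2 * (p ∸ 1) ⟩) P → n ≋ c ⟨mod 2 * carmichaelSqfree P ⟩
  combine [] (n≋c , []) = n≋c
  combine (p ∷ Q) (n≋c , n≋c[p] ∷ n≋c[Q]) = ≋-*lcm 2 {p ∸ 1} {carmichaelSqfree Q} n≋c[p] (combine Q (n≋c , n≋c[Q]))
  separate : ∀ P → n ≋ c ⟨mod 2 * carmichaelSqfree P ⟩ → n ≋ c ⟨mod 2 ⟩ × All (λ p → n ≋ c ⟨mod 2 * (p ∸ 1) ⟩) P
  separate P n≋c = ≋-weaken (m∣m*n (carmichaelSqfree P)) n≋c
                 , All.map (λ p-1∣λ → ≋-weaken (*-monoʳ-∣ 2 p-1∣λ) n≋c) (∣carmichael P)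

primes-∣⇔product-∣ : ∀ {n} P → Unique P → All Prime P → All (_∣ n) P ⇔ product P ∣ n
primes-∣⇔product-∣ {n} P uP pP = mk⇔ (combine P uP pP) (separate P)
  where
  combine : ∀ P → Unique P → All Prime P → All (_∣ n) P → product P ∣ n
  combine [] _ _ [] = 1∣ n
  combine (p ∷ Q) (p∉Q ∷ uQ) (pp ∷ pQ) (p∣n ∷ Q∣n) =
    coprime-∣-* (head-coprime-tail Q pp pQ p∉Q) p∣n (combine Q uQ pQ Q∣n)
  separate : ∀ P → product P ∣ n → All (_∣ n) P
  separate [] _ = []
  separate (p ∷ Q) pQ∣n = ∣-trans (m∣m*n (product Q)) pQ∣n ∷ separate Q (∣-trans (n∣m*n p) pQ∣n)

All-⇔ : ∀ {A B : ℕ → Set} {xs} → All (λ x → A x ⇔ B x) xs → All A xs ⇔ All B xs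
All-⇔ A⇔B = mk⇔ (λ all-A → All.zipWith (λ (e , a) → to e a) (A⇔B , all-A))
                 (λ all-B → All.zipWith (λ (e , b) → from e b) (A⇔B , all-B))

intersection⇔ : ∀ {n} P → Unique P → All OddPrime P → P ≢ [] →
  All (λ p → InF p n) P ⇔ (product P ∣ n × n ≋ 1 ⟨mod 2 * carmichaelSqfree P ⟩)
intersection⇔ [] _ _ P≢[] = ⊥-elim (P≢[] refl)
intersection⇔ {n} P@(p ∷ Q) uP oddP _ =
  ⇔.trans (All-⇔ (All.map InF⇔ oddP))
  (⇔.trans (mk⇔ All.unzip All.zip)
           (primes-∣⇔product-∣ P uP (allPrime oddP) ×-⇔ ⇔.trans mod2-redundant (≋-carmichael P)))
  where
  mod2-redundant : All (λ p → n ≋ 1 ⟨mod 2 * (p ∸ 1) ⟩) P ⇔ (n ≋ 1 ⟨mod 2 ⟩ × All (λ p → n ≋ 1 ⟨mod 2 * (p ∸ 1) ⟩) P)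
  mod2-redundant = mk⇔ (λ { all@(n≋1 ∷ _) → ≋-weaken (m∣m*n (p ∸ 1)) n≋1 , all }) proj₂

mainTheorem12 : (P : List ℕ) → Unique P → All OddPrime P → P ≢ [] →
    ((∃ λ n → All (λ p → InF p n) P) ⇔ InM (product P))
    × (InM (product P) →
        ∃ λ a → (n : ℕ) →
          (All (λ p → InF p n) P
            ⇔ (0 < n × n ≡ a [mod 2 * product P * carmichaelSqfree P ])))
mainTheorem12 P uP oddP P≢[] = mk⇔ nonempty⇒InM InM⇒nonempty , InM⇒progression
  where
  m M : ℕ
  m = product P
  M = 2 * carmichaelSqfree P
  intersection : ∀ n → All (λ p → InF p n) P ⇔ (m ∣ n × n ≋ 1 ⟨mod M ⟩)
  intersection n = intersection⇔ P uP oddP P≢[]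
  InM⇔ : InM m ⇔ Coprime m M
  InM⇔ = InM⇔coprime P uP oddP P≢[]
  nonempty⇒InM : (∃ λ n → All (λ p → InF p n) P) → InM m
  nonempty⇒InM (n , n∈⋂) = let (m∣n , n≋1) = to (intersection n) n∈⋂ in from InM⇔ (crt-necessary m∣n n≋1)
  InM⇒nonempty : InM m → ∃ λ n → All (λ p → InF p n) P
  InM⇒nonempty m∈M = let (n , m∣n , n≋1) = crt-exists (to InM⇔ m∈M) in n , from (intersection n) (m∣n , n≋1)
  InM⇒progression : InM m → ∃ λ a → ∀ n → All (λ p → InF p n) P ⇔ (0 < n × n ≡ a [mod 2 * m * carmichaelSqfree P ])
  InM⇒progression m∈M = let (a , m∣a , a≋1) = crt-exists (to InM⇔ m∈M) in
    a , λ n → ⇔.trans (intersection n)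
              (⇔.trans (crt-solutions (to InM⇔ m∈M) m∣a a≋1 n) (residue-class⇔ m (carmichaelSqfree P) a≋1))
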